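{- Let $c=\langle\delta,\mathrm{obs}\rangle\colon S\to(FTS)^A\times O$ and $c'=\langle\delta',\mathrm{obs}'\rangle\colon S'\to(FTS')^A\times O'$ be partially observable $FT(\_)^A$-coalgebras, and let $(f,g)$ be a morphism from $c$ to $c'$, i.e. $f\colon S\to S'$ in $\mathcal{C}$ and $g\colon O\to O'$ in $\mathcal{O}$ with $\delta'\circ f=(FTf)^A\circ\delta$ and $g\circ\mathrm{obs}=\mathrm{obs}'\circ f$. Then for every morphism $u\colon O'\to A$, $f$ is an $FT$-coalgebra morphism from $c_{u\circ g}$ to $c'_u$, i.e. $c'_u\circ f=FTf\circ c_{u\circ g}$.
   Context: $\mathcal{C}$ is a cartesian closed category (with finite products), $\mathcal{O}$ a wide subcategory of $\mathcal{C}$, $F$ an endofunctor and $T$ a monad on $\mathcal{C}$, $A$ a fixed object. For a partially observable coalgebra $e=\langle\gamma,p\rangle\colon X\to(FTX)^A\times P$ and $u\colon P\to A$, $e_u:=\mathrm{ev}\circ\langle\gamma,u\circ p\rangle\colon X\to FTX$, where $\mathrm{ev}\colon(FTX)^A\times A\to FTX$ is evaluation. -}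

module Defs where

open import Level using (Level; _⊔_) renaming (suc to lsuc)
open import Relation.Binary using (Rel; IsEquivalence)

record Category (o ℓ e : Level) : Set (lsuc (o ⊔ ℓ ⊔ e)) where
  infixr 9 _∘_
  infix  4 _≈_
  infix  5 _⇒_
  field
    Obj       : Set o
    _⇒_       : Obj → Obj → Set ℓ
    _≈_       : ∀ {A B} → Rel (A ⇒ B) e
    id        : ∀ {A} → A ⇒ A
    _∘_       : ∀ {A B C} → B ⇒ C → A ⇒ B → A ⇒ C
    equiv     : ∀ {A B} → IsEquivalence (_≈_ {A} {B})
    assoc     : ∀ {A B C D} {f : A ⇒ B} {g : B ⇒ C} {h : C ⇒ D} →
                (h ∘ g) ∘ f ≈ h ∘ (g ∘ f)
    identityˡ : ∀ {A B} {f : A ⇒ B} → id ∘ f ≈ f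
    identityʳ : ∀ {A B} {f : A ⇒ B} → f ∘ id ≈ f
    ∘-resp-≈  : ∀ {A B C} {f h : B ⇒ C} {g i : A ⇒ B} →
                f ≈ h → g ≈ i → f ∘ g ≈ h ∘ i

record CCC (o ℓ e : Level) : Set (lsuc (o ⊔ ℓ ⊔ e)) where
  field
    category : Category o ℓ e
  open Category category public
  infixr 7 _×_
  field
    ⊤        : Obj
    !        : ∀ {A} → A ⇒ ⊤
    !-unique : ∀ {A} (f : A ⇒ ⊤) → ! ≈ f
    _×_      : Obj → Obj → Obj
    π₁       : ∀ {A B} → A × B ⇒ A
    π₂       : ∀ {A B} → A × B ⇒ B
    ⟨_,_⟩    : ∀ {X A B} → X ⇒ A → X ⇒ B → X ⇒ A × B
    project₁ : ∀ {X A B} {f : X ⇒ A} {g : X ⇒ B} → π₁ ∘ ⟨ f , g ⟩ ≈ f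
    project₂ : ∀ {X A B} {f : X ⇒ A} {g : X ⇒ B} → π₂ ∘ ⟨ f , g ⟩ ≈ g
    ×-unique : ∀ {X A B} {h : X ⇒ A × B} {f : X ⇒ A} {g : X ⇒ B} →
               π₁ ∘ h ≈ f → π₂ ∘ h ≈ g → ⟨ f , g ⟩ ≈ h
  _⁂_ : ∀ {A B C D} → A ⇒ B → C ⇒ D → A × C ⇒ B × D
  f ⁂ g = ⟨ f ∘ π₁ , g ∘ π₂ ⟩
  infixr 8 _^_
  field
    _^_      : Obj → Obj → Obj
    eval     : ∀ {A B} → (B ^ A) × A ⇒ B
    curry    : ∀ {X A B} → X × A ⇒ B → X ⇒ B ^ A
    β        : ∀ {X A B} {h : X × A ⇒ B} → eval ∘ (curry h ⁂ id) ≈ h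
    λ-unique : ∀ {X A B} {h : X × A ⇒ B} {k : X ⇒ B ^ A} →
               eval ∘ (k ⁂ id) ≈ h → k ≈ curry h
  _^₁_ : ∀ {X Y} → X ⇒ Y → (A : Obj) → X ^ A ⇒ Y ^ A
  h ^₁ A = curry (h ∘ eval)

record Endofunctor {o ℓ e} (𝒞 : Category o ℓ e) : Set (o ⊔ ℓ ⊔ e) where
  open Category 𝒞
  field
    F₀           : Obj → Obj
    F₁           : ∀ {A B} → A ⇒ B → F₀ A ⇒ F₀ B
    identity     : ∀ {A} → F₁ (id {A}) ≈ id
    homomorphism : ∀ {A B C} {f : A ⇒ B} {g : B ⇒ C} → F₁ (g ∘ f) ≈ F₁ g ∘ F₁ f
    F-resp-≈     : ∀ {A B} {f g : A ⇒ B} → f ≈ g → F₁ f ≈ F₁ g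

record Monad {o ℓ e} (𝒞 : Category o ℓ e) : Set (o ⊔ ℓ ⊔ e) where
  open Category 𝒞
  field
    functor : Endofunctor 𝒞
  open Endofunctor functor public renaming (F₀ to T₀; F₁ to T₁)
  field
    η        : ∀ X → X ⇒ T₀ X
    μ        : ∀ X → T₀ (T₀ X) ⇒ T₀ X
    η-natural : ∀ {X Y} {f : X ⇒ Y} → η Y ∘ f ≈ T₁ f ∘ η X
    μ-natural : ∀ {X Y} {f : X ⇒ Y} → μ Y ∘ T₁ (T₁ f) ≈ T₁ f ∘ μ X
    μ-assoc   : ∀ {X} → μ X ∘ T₁ (μ X) ≈ μ X ∘ μ (T₀ X)
    μ-unitˡ   : ∀ {X} → μ X ∘ T₁ (η X) ≈ id
    μ-unitʳ   : ∀ {X} → μ X ∘ η (T₀ X) ≈ id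

record WideSubcategory {o ℓ e} (𝒞 : Category o ℓ e) (p : Level)
       : Set (o ⊔ ℓ ⊔ lsuc p) where
  open Category 𝒞
  field
    Mor   : ∀ {A B} → A ⇒ B → Set p
    id-O  : ∀ {A} → Mor (id {A})
    ∘-O   : ∀ {A B C} {f : B ⇒ C} {g : A ⇒ B} → Mor f → Mor g → Mor (f ∘ g)

module _ {o ℓ e p} (𝒞 : CCC o ℓ e) (𝒪 : WideSubcategory (CCC.category 𝒞) p)
         (F : Endofunctor (CCC.category 𝒞)) (T : Monad (CCC.category 𝒞))
         (A : CCC.Obj 𝒞) where
  open CCC 𝒞
  open Endofunctor F
  open Monad T using (T₀; T₁)

  FT₀ : Obj → Obj
  FT₀ X = F₀ (T₀ X)

  FT₁ : ∀ {X Y} → X ⇒ Y → FT₀ X ⇒ FT₀ Y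
  FT₁ f = F₁ (T₁ f)

  record POCoalg : Set (o ⊔ ℓ) where
    field
      State : Obj
      Obs   : Obj
      δ     : State ⇒ FT₀ State ^ A
      obs   : State ⇒ Obs

    structure : State ⇒ (FT₀ State ^ A) × Obs
    structure = ⟨ δ , obs ⟩

    _at_ : Obs ⇒ A → State ⇒ FT₀ State
    _at_ u = eval ∘ ⟨ δ , u ∘ obs ⟩

  record POMorphism (c c' : POCoalg) : Set (ℓ ⊔ e ⊔ p) where
    private
      module c  = POCoalg c
      module c' = POCoalg c'
    field
      f      : c.State ⇒ c'.State
      g      : c.Obs ⇒ c'.Obs
      g∈𝒪    : WideSubcategory.Mor 𝒪 g
      δ-comm : c'.δ ∘ f ≈ (FT₁ f ^₁ A) ∘ c.δ
      obs-comm : g ∘ c.obs ≈ c'.obs ∘ f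

module Submission where

open import Defs
open import Relation.Binary using (Setoid; IsEquivalence)
import Relation.Binary.Reasoning.Setoid as SetoidReasoning

module CCCProperties {o ℓ e} (𝒞 : CCC o ℓ e) where
  open CCC 𝒞

  hom-setoid : Obj → Obj → Setoid ℓ e
  hom-setoid X Y = record { Carrier = X ⇒ Y ; _≈_ = _≈_ ; isEquivalence = equiv }

  module HomReasoning {X Y : Obj} = SetoidReasoning (hom-setoid X Y)
  open module ≈ {X Y : Obj} = IsEquivalence (equiv {X} {Y}) public using (refl; sym; trans)

  ∘-resp-≈ˡ : ∀ {X Y Z} {f g : Y ⇒ Z} {h : X ⇒ Y} → f ≈ g → f ∘ h ≈ g ∘ h
  ∘-resp-≈ˡ p = ∘-resp-≈ p refl

  ∘-resp-≈ʳ : ∀ {X Y Z} {f : Y ⇒ Z} {g h : X ⇒ Y} → g ≈ h → f ∘ g ≈ f ∘ h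
  ∘-resp-≈ʳ p = ∘-resp-≈ refl p

  ⟨⟩-cong : ∀ {X B C} {a a′ : X ⇒ B} {b b′ : X ⇒ C} →
            a ≈ a′ → b ≈ b′ → ⟨ a , b ⟩ ≈ ⟨ a′ , b′ ⟩
  ⟨⟩-cong pa pb = ×-unique (trans project₁ (sym pa)) (trans project₂ (sym pb))

  ⟨⟩∘ : ∀ {W X B C} {a : X ⇒ B} {b : X ⇒ C} {h : W ⇒ X} →
        ⟨ a , b ⟩ ∘ h ≈ ⟨ a ∘ h , b ∘ h ⟩
  ⟨⟩∘ = sym (×-unique (trans (sym assoc) (∘-resp-≈ˡ project₁))
                      (trans (sym assoc) (∘-resp-≈ˡ project₂)))

  ⁂∘⟨⟩ : ∀ {X B B′ C C′} {k : B ⇒ B′} {l : C ⇒ C′} {a : X ⇒ B} {b : X ⇒ C} →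
         (k ⁂ l) ∘ ⟨ a , b ⟩ ≈ ⟨ k ∘ a , l ∘ b ⟩
  ⁂∘⟨⟩ = trans ⟨⟩∘ (⟨⟩-cong (trans assoc (∘-resp-≈ʳ project₁))
                            (trans assoc (∘-resp-≈ʳ project₂)))

  eval-natural : ∀ {X Y Z B} {h : Y ⇒ Z} {k : X ⇒ Y ^ B} {a : X ⇒ B} →
                 eval ∘ ⟨ (h ^₁ B) ∘ k , a ⟩ ≈ h ∘ (eval ∘ ⟨ k , a ⟩)
  eval-natural {h = h} {k} {a} = begin
    eval ∘ ⟨ (h ^₁ _) ∘ k , a ⟩              ≈⟨ ∘-resp-≈ʳ (⟨⟩-cong refl (sym identityˡ)) ⟩
    eval ∘ ⟨ (h ^₁ _) ∘ k , id ∘ a ⟩         ≈⟨ ∘-resp-≈ʳ (sym ⁂∘⟨⟩) ⟩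
    eval ∘ (((h ^₁ _) ⁂ id) ∘ ⟨ k , a ⟩)    ≈⟨ sym assoc ⟩
    (eval ∘ ((h ^₁ _) ⁂ id)) ∘ ⟨ k , a ⟩    ≈⟨ ∘-resp-≈ˡ β ⟩
    (h ∘ eval) ∘ ⟨ k , a ⟩                   ≈⟨ assoc ⟩
    h ∘ (eval ∘ ⟨ k , a ⟩)                   ∎
    where open HomReasoning

lemma7p2 : ∀ {o ℓ e p} (𝒞 : CCC o ℓ e) (𝒪 : WideSubcategory (CCC.category 𝒞) p)
    (F : Endofunctor (CCC.category 𝒞)) (T : Monad (CCC.category 𝒞))
    (A : CCC.Obj 𝒞) (c c' : POCoalg 𝒞 𝒪 F T A)
    (m : POMorphism 𝒞 𝒪 F T A c c')
    (u : CCC._⇒_ 𝒞 (POCoalg.Obs c') A) →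
    let open CCC 𝒞
        open POMorphism m
    in POCoalg._at_ c' u ∘ f ≈ FT₁ 𝒞 𝒪 F T A f ∘ POCoalg._at_ c (u ∘ g)
lemma7p2 𝒞 𝒪 F T A c c' m u = begin
  (eval ∘ ⟨ c′.δ , u ∘ c′.obs ⟩) ∘ f
    ≈⟨ assoc ⟩
  eval ∘ (⟨ c′.δ , u ∘ c′.obs ⟩ ∘ f)
    ≈⟨ ∘-resp-≈ʳ ⟨⟩∘ ⟩
  eval ∘ ⟨ c′.δ ∘ f , (u ∘ c′.obs) ∘ f ⟩
    ≈⟨ ∘-resp-≈ʳ (⟨⟩-cong δ-comm observation-comm) ⟩
  eval ∘ ⟨ (FT₁ 𝒞 𝒪 F T A f ^₁ A) ∘ c.δ , (u ∘ g) ∘ c.obs ⟩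
    ≈⟨ eval-natural ⟩
  FT₁ 𝒞 𝒪 F T A f ∘ (eval ∘ ⟨ c.δ , (u ∘ g) ∘ c.obs ⟩)
    ∎
  where
  open CCC 𝒞
  open CCCProperties 𝒞
  open HomReasoning
  open POMorphism m
  module c = POCoalg c
  module c′ = POCoalg c'

  observation-comm : (u ∘ c′.obs) ∘ f ≈ (u ∘ g) ∘ c.obs
  observation-comm = begin
    (u ∘ c′.obs) ∘ f  ≈⟨ assoc ⟩
    u ∘ (c′.obs ∘ f)  ≈⟨ ∘-resp-≈ʳ (sym obs-comm) ⟩
    u ∘ (g ∘ c.obs)   ≈⟨ sym assoc ⟩
    (u ∘ g) ∘ c.obs   ∎
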